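{- For every positive integer $m$ there exist a positive integer $k$ and positive integers $n_1,n_2,\dots,n_k$ such that $$m=\frac{1}{n_1}+\frac{1}{n_2}+\cdots+\frac{1}{n_k}$$ and $\sum_{i\in I}\frac{1}{n_i}\notin\mathbb{Z}$ for every subset $I$ with $\emptyset\neq I\subsetneq\{1,2,\dots,k\}$. -}

module Defs where

open import Data.Nat using (ℕ; zero; suc)
open import Data.Integer using (ℤ; +_)
open import Data.Rational using (ℚ; _+_; _/_; 0ℚ)
open import Data.Bool using (Bool; true; false; if_then_else_)
open import Data.Fin using (Fin)
open import Data.Fin.Subset using (Subset)
open import Data.Vec using (Vec; []; _∷_; tabulate; zipWith; foldr)

-- 1/n as a rational; only ever used for n ≥ 1 (the value at 0 is an irrelevant default)
unitFrac : ℕ → ℚ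
unitFrac zero    = 0ℚ
unitFrac (suc d) = (+ 1) / suc d

subsetSum : ∀ {k} → (Fin k → ℕ) → Subset k → ℚ
subsetSum {k} n I = foldr (λ _ → ℚ) _+_ 0ℚ
  (zipWith (λ b q → if b then q else 0ℚ) I (tabulate (λ i → unitFrac (n i))))

fullSum : ∀ {k} → (Fin k → ℕ) → ℚ
fullSum n = foldr (λ _ → ℚ) _+_ 0ℚ (tabulate (λ i → unitFrac (n i)))

IsInteger : ℚ → Set
IsInteger q = Σ ℤ λ z → q ≡ z / 1
  where open import Data.Product using (Σ)
        open import Relation.Binary.PropositionalEquality using (_≡_)

{-# OPTIONS --safe #-}
-- Write m = 1/D + Σ aᵢ/D with nᵢ aᵢ = D, and call this indivisible when no nonempty set of the aᵢ
-- sums to a multiple of D. Then an integral subsum either avoids 1/D, so its own aᵢ sum to a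
-- multiple of D, or contains it, so the complementary aᵢ do; hence only the empty and the full
-- subsum can be integers. Start from 1 = 1/6 + 1/2 + 1/3. For D ≥ 3 the identity
--   1/(D (D-1) (2D-1)) + (D-2)/(D-1) + 4/(2D-1) = 1 + 1/D
-- replaces 1/D by 1/(D (D-1) (2D-1)) plus D-2 copies of 1/(D-1) and 4 copies of 1/(2D-1),
-- raising the total by one. Indivisibility survives because D-1 and 2D-1 are each coprime to
-- the product of the other two factors and each occurs fewer times than its own size.
module Submission where

open import Defs
open import Data.Nat using (ℕ; _≥_; _>_)
open import Data.Integer using (+_)
open import Data.Rational using (_/_)
open import Data.Fin using (Fin)
open import Data.Fin.Subset using (Subset; Nonempty; _⊂_; ⊤)
open import Data.Product using (Σ; _×_)
open import Relation.Binary.PropositionalEquality using (_≡_)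
open import Relation.Nullary using (¬_)

open import Data.Nat using (zero; suc; _+_; _*_; _<_; z≤n; s≤s; NonZero; >-nonZero)
open import Data.Nat.Properties
  using ( +-assoc; +-identityʳ; +-cancelʳ-≡; *-comm; *-identityˡ; *-identityʳ; *-zeroʳ; *-distribˡ-+
        ; n≮0; n<1+n; m≤m+n; ≤-reflexive; <-≤-trans; ≤-<-trans; m*n≢0; +-commutativeSemigroup )
open import Algebra.Properties.CommutativeSemigroup +-commutativeSemigroup using (x∙yz≈y∙xz; x∙yz≈xz∙y)
open import Data.Nat.Divisibility
  using ( _∣_; divides; _∣?_; ∣-trans; ∣1⇒≡1; ∣m∣n⇒∣m+n; ∣m+n∣m⇒∣n; ∣m⇒∣m*n; ∣n⇒∣m*n
        ; m∣m*n; n∣m*n; >⇒∤; *-cancelˡ-∣ )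
open import Data.Nat.Coprimality as Coprime using (Coprime; coprime-divisor)
import Data.Nat.Tactic.RingSolver as ℕ-Solver
import Data.Integer as ℤ
open import Data.Integer.Properties using (pos-*; abs-*)
import Data.Integer.Tactic.RingSolver as ℤ-Solver
import Data.Rational as ℚ
open import Data.Rational using (fromℚᵘ)
open import Data.Rational.Properties
  using (toℚᵘ-injective; toℚᵘ-homo-+; toℚᵘ-fromℚᵘ; fromℚᵘ-cong; /-injective-≃; 0/n≡0)
  renaming (+-identityˡ to ℚ-+-identityˡ)
open import Data.Rational.Unnormalised using (mkℚᵘ; *≡*)
import Data.Rational.Unnormalised as ℚᵘ
import Data.Rational.Unnormalised.Properties as ℚᵘ
import Data.Fin as Fin
open import Data.Fin.Subset using (Side; inside; outside; ⊥; ∁; ∣_∣; _∈_)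
open import Data.Fin.Subset.Properties using (∉⊥; Empty-unique; ∣⊤∣≡n; ∣p∣≤n; x∈p⇒∣p-x∣<∣p∣; x∉p⇒x∈∁p)
open import Data.Vec using (Vec; []; _∷_; here; there; lookup; _++_; map; replicate; splitAt)
open import Data.Vec.Relation.Binary.Pointwise.Inductive as Pointwise using (Pointwise; []; _∷_; ++⁺)
open import Data.Product using (_,_; proj₂; ∃-syntax)
open import Function using (_∘_)
open import Relation.Nullary using (contradiction)
open import Relation.Nullary.Decidable using (from-no)
open import Relation.Binary.PropositionalEquality
  using (refl; sym; trans; cong; cong₂; subst; subst₂; module ≡-Reasoning)

open ≡-Reasoning

fromℚᵘ-homo-+ : ∀ p q → fromℚᵘ (p ℚᵘ.+ q) ≡ fromℚᵘ p ℚ.+ fromℚᵘ q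
fromℚᵘ-homo-+ p q = toℚᵘ-injective (ℚᵘ.≃-sym (ℚᵘ.≃-trans (toℚᵘ-homo-+ (fromℚᵘ p) (fromℚᵘ q))
  (ℚᵘ.≃-trans (ℚᵘ.+-cong (toℚᵘ-fromℚᵘ p) (toℚᵘ-fromℚᵘ q)) (ℚᵘ.≃-sym (toℚᵘ-fromℚᵘ (p ℚᵘ.+ q))))))

/-cong-cross : ∀ {x y a b} → x * suc b ≡ y * suc a → (+ x) / suc a ≡ (+ y) / suc b
/-cong-cross {x} {y} {a} {b} eq = fromℚᵘ-cong {mkℚᵘ (+ x) a} {mkℚᵘ (+ y) b}
  (*≡* (trans (sym (pos-* x (suc b))) (trans (cong +_ eq) (pos-* y (suc a)))))

/-distribʳ-+ : ∀ x y p → (+ (x + y)) / suc p ≡ (+ x) / suc p ℚ.+ (+ y) / suc p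
/-distribʳ-+ x y p = trans (fromℚᵘ-cong {mkℚᵘ (+ (x + y)) p} {mkℚᵘ (+ x) p ℚᵘ.+ mkℚᵘ (+ y) p} sum≃)
                           (fromℚᵘ-homo-+ (mkℚᵘ (+ x) p) (mkℚᵘ (+ y) p))
  where
  sum≃ : mkℚᵘ (+ (x + y)) p ℚᵘ.≃ (mkℚᵘ (+ x) p ℚᵘ.+ mkℚᵘ (+ y) p)
  sum≃ = *≡* (begin
    + (x + y) ℤ.* + (suc p * suc p)                    ≡⟨ cong (+ (x + y) ℤ.*_) (pos-* (suc p) (suc p)) ⟩
    + (x + y) ℤ.* (+ suc p ℤ.* + suc p)                ≡⟨ distrib (+ x) (+ y) (+ suc p) ⟩
    (+ x ℤ.* + suc p ℤ.+ + y ℤ.* + suc p) ℤ.* + suc p ∎)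
    where
    distrib : ∀ a b d → (a ℤ.+ b) ℤ.* (d ℤ.* d) ≡ (a ℤ.* d ℤ.+ b ℤ.* d) ℤ.* d
    distrib = ℤ-Solver.solve-∀

/≡integer⇒∣ : ∀ {N p z} → (+ N) / suc p ≡ z / 1 → suc p ∣ N
/≡integer⇒∣ {N} {p} {z} eq with /-injective-≃ (mkℚᵘ (+ N) p) (mkℚᵘ z 0) eq
... | *≡* cross = divides ℤ.∣ z ∣ (begin
  N                     ≡⟨ sym (*-identityʳ N) ⟩
  N * 1                 ≡⟨ sym (abs-* (+ N) (+ 1)) ⟩
  ℤ.∣ + N ℤ.* + 1 ∣     ≡⟨ cong ℤ.∣_∣ cross ⟩
  ℤ.∣ z ℤ.* + suc p ∣   ≡⟨ abs-* z (+ suc p) ⟩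
  ℤ.∣ z ∣ * suc p       ∎)

unitFrac≡/ : ∀ {d a p} → d * a ≡ suc p → unitFrac d ≡ (+ a) / suc p
unitFrac≡/ {suc d} {a} {p} eq = /-cong-cross {1} {a} {d} {p} (begin
  1 * suc p   ≡⟨ *-identityˡ (suc p) ⟩
  suc p       ≡⟨ sym eq ⟩
  suc d * a   ≡⟨ *-comm (suc d) a ⟩
  a * suc d   ∎)

sumOver : ∀ {n} → Subset n → Vec ℕ n → ℕ
sumOver []            []       = 0
sumOver (inside ∷ p)  (a ∷ as) = a + sumOver p as
sumOver (outside ∷ p) (a ∷ as) = sumOver p as

subsetSum-scaled : ∀ {p k} {ds as : Vec ℕ k} → Pointwise (λ d a → d * a ≡ suc p) ds as →
                   ∀ J → subsetSum (lookup ds) J ≡ (+ sumOver J as) / suc p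
subsetSum-scaled {p} [] [] = sym (0/n≡0 (suc p))
subsetSum-scaled {p} {ds = d ∷ ds} {a ∷ as} (eq ∷ scaled) (inside ∷ J) = begin
  unitFrac d ℚ.+ subsetSum (lookup ds) J   ≡⟨ cong₂ ℚ._+_ (unitFrac≡/ {d} {a} eq) (subsetSum-scaled scaled J) ⟩
  (+ a) / suc p ℚ.+ (+ sumOver J as) / suc p ≡⟨ sym (/-distribʳ-+ a (sumOver J as) p) ⟩
  (+ (a + sumOver J as)) / suc p           ∎
subsetSum-scaled (eq ∷ scaled) (outside ∷ J) = trans (ℚ-+-identityˡ _) (subsetSum-scaled scaled J)

fullSum≡subsetSum⊤ : ∀ {k} (n : Fin k → ℕ) → fullSum n ≡ subsetSum n ⊤
fullSum≡subsetSum⊤ {zero}  n = refl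
fullSum≡subsetSum⊤ {suc k} n = cong (unitFrac (n Fin.zero) ℚ.+_) (fullSum≡subsetSum⊤ (n ∘ Fin.suc))

sumOver-++ : ∀ {m n} (p : Subset m) (q : Subset n) xs ys → sumOver (p ++ q) (xs ++ ys) ≡ sumOver p xs + sumOver q ys
sumOver-++ []            q []       ys = refl
sumOver-++ (inside ∷ p)  q (x ∷ xs) ys = trans (cong (_+_ x) (sumOver-++ p q xs ys)) (sym (+-assoc x _ _))
sumOver-++ (outside ∷ p) q (x ∷ xs) ys = sumOver-++ p q xs ys

sumOver-map-* : ∀ {n} c (p : Subset n) as → sumOver p (map (c *_) as) ≡ c * sumOver p as
sumOver-map-* c []            []       = sym (*-zeroʳ c)
sumOver-map-* c (inside ∷ p)  (a ∷ as) = trans (cong (_+_ (c * a)) (sumOver-map-* c p as)) (sym (*-distribˡ-+ c a _))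
sumOver-map-* c (outside ∷ p) (a ∷ as) = sumOver-map-* c p as

sumOver-replicate : ∀ {n} (p : Subset n) v → sumOver p (replicate n v) ≡ ∣ p ∣ * v
sumOver-replicate []            v = refl
sumOver-replicate (inside ∷ p)  v = cong (_+_ v) (sumOver-replicate p v)
sumOver-replicate (outside ∷ p) v = sumOver-replicate p v

sumOver-∁ : ∀ {n} (p : Subset n) as → sumOver p as + sumOver (∁ p) as ≡ sumOver ⊤ as
sumOver-∁ []            []       = refl
sumOver-∁ (inside ∷ p)  (a ∷ as) = trans (+-assoc a _ _) (cong (_+_ a) (sumOver-∁ p as))
sumOver-∁ (outside ∷ p) (a ∷ as) = begin
  sumOver p as + (a + sumOver (∁ p) as) ≡⟨ x∙yz≈y∙xz (sumOver p as) a _ ⟩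
  a + (sumOver p as + sumOver (∁ p) as) ≡⟨ cong (_+_ a) (sumOver-∁ p as) ⟩
  a + sumOver ⊤ as                      ∎

∣p∣≡0⇒p≡⊥ : ∀ {n} {p : Subset n} → ∣ p ∣ ≡ 0 → p ≡ ⊥
∣p∣≡0⇒p≡⊥ ∣p∣≡0 = Empty-unique λ (_ , x∈p) → n≮0 (<-≤-trans (x∈p⇒∣p-x∣<∣p∣ x∈p) (≤-reflexive ∣p∣≡0))

replicate-++ : ∀ {A : Set} m n (x : A) → replicate m x ++ replicate n x ≡ replicate (m + n) x
replicate-++ zero    n x = refl
replicate-++ (suc m) n x = cong (x ∷_) (replicate-++ m n x)

∣∧<⇒≡0 : ∀ {m n} → m ∣ n → n < m → n ≡ 0
∣∧<⇒≡0 {n = zero}  _   _   = refl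
∣∧<⇒≡0 {n = suc _} m∣n n<m = contradiction m∣n (>⇒∤ n<m)

unit-Bézout⇒coprime : ∀ {m n} x y → x * m + 1 ≡ y * n → Coprime m n
unit-Bézout⇒coprime x y eq {d} (d∣m , d∣n) =
  ∣1⇒≡1 (∣m+n∣m⇒∣n (subst (d ∣_) (sym eq) (∣n⇒∣m*n y d∣n)) (∣n⇒∣m*n x d∣m))

coefficient-vanishes : ∀ {b M X y} → Coprime b M → y < b → b ∣ X → b ∣ X + y * M → y ≡ 0
coefficient-vanishes {b} {M} {X} {y} b⊥M y<b b∣X b∣ =
  ∣∧<⇒≡0 (coprime-divisor b⊥M (subst (b ∣_) (*-comm y M) (∣m+n∣m⇒∣n b∣ b∣X))) y<b

indivisible-combination : ∀ {a b c N y z} → Coprime b (a * c) → Coprime c (a * b) → y < b → z < c →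
  a * (b * c) ∣ b * c * N + (y * (a * c) + z * (a * b)) → y ≡ 0 × z ≡ 0 × a ∣ N
indivisible-combination {a} {b} {c} {N} {y} {z} b⊥ac c⊥ab y<b z<c abc∣ = y≡0 , z≡0 , a∣N
  where
  y≡0 : y ≡ 0
  y≡0 = coefficient-vanishes b⊥ac y<b
          (∣m∣n⇒∣m+n (∣m⇒∣m*n N (m∣m*n c)) (∣n⇒∣m*n z (n∣m*n a)))
          (subst (b ∣_) (x∙yz≈xz∙y (b * c * N) _ _) (∣-trans (∣n⇒∣m*n a (m∣m*n c)) abc∣))
  z≡0 : z ≡ 0
  z≡0 = coefficient-vanishes c⊥ab z<c
          (∣m∣n⇒∣m+n (∣m⇒∣m*n N (n∣m*n b)) (∣n⇒∣m*n y (n∣m*n a)))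
          (subst (c ∣_) (sym (+-assoc (b * c * N) _ _)) (∣-trans (∣n⇒∣m*n a (n∣m*n b)) abc∣))
  instance
    b*c≢0 : NonZero (b * c)
    b*c≢0 = m*n≢0 b c {{>-nonZero (≤-<-trans z≤n y<b)}} {{>-nonZero (≤-<-trans z≤n z<c)}}
  a∣N : a ∣ N
  a∣N = *-cancelˡ-∣ (b * c) (subst₂ _∣_ (*-comm a (b * c)) (+-identityʳ (b * c * N))
          (subst₂ (λ y z → a * (b * c) ∣ b * c * N + (y * (a * c) + z * (a * b))) y≡0 z≡0 abc∣))

rescaled-total : ∀ {m D Q S X} → 1 + S ≡ m * D → 1 + X ≡ (1 + D) * Q → 1 + (Q * S + X) ≡ suc m * (D * Q)
rescaled-total {m} {D} {Q} {S} {X} total identity = +-cancelʳ-≡ Q (1 + (Q * S + X)) (suc m * (D * Q)) (begin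
  1 + (Q * S + X) + Q        ≡⟨ regroup Q S X ⟩
  Q * (1 + S) + (1 + X)      ≡⟨ cong₂ _+_ (cong (Q *_) total) identity ⟩
  Q * (m * D) + (1 + D) * Q  ≡⟨ expand m D Q ⟩
  suc m * (D * Q) + Q        ∎)
  where
  regroup : ∀ Q S X → 1 + (Q * S + X) + Q ≡ Q * (1 + S) + (1 + X)
  regroup = ℕ-Solver.solve-∀
  expand : ∀ m D Q → Q * (m * D) + (1 + D) * Q ≡ suc m * (D * Q) + Q
  expand = ℕ-Solver.solve-∀

record Decomposition (m D : ℕ) : Set where
  field
    k            : ℕ
    denominators : Vec ℕ k
    numerators   : Vec ℕ k
    scaled       : Pointwise (λ d a → d * a ≡ D) denominators numerators
    total        : 1 + sumOver ⊤ numerators ≡ m * D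
    indivisible  : ∀ J → D ∣ sumOver J numerators → J ≡ ⊥

base : Decomposition 1 6
base = record
  { k = 2 ; denominators = 2 ∷ 3 ∷ [] ; numerators = 3 ∷ 2 ∷ []
  ; scaled = refl ∷ refl ∷ [] ; total = refl ; indivisible = indivisible }
  where
  indivisible : ∀ J → 6 ∣ sumOver J (3 ∷ 2 ∷ []) → J ≡ ⊥
  indivisible (outside ∷ outside ∷ []) _   = refl
  indivisible (inside  ∷ outside ∷ []) 6∣3 = contradiction 6∣3 (from-no (6 ∣? 3))
  indivisible (outside ∷ inside  ∷ []) 6∣2 = contradiction 6∣2 (from-no (6 ∣? 2))
  indivisible (inside  ∷ inside  ∷ []) 6∣5 = contradiction 6∣5 (from-no (6 ∣? 5))

module Extension {m D} (dec : Decomposition m D) (q₁ q₂ c e : ℕ)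
  -- 1/(D q₁ q₂) + c/q₁ + e/q₂ = 1 + 1/D, with denominators cleared
  (identity : 1 + (c * (D * q₂) + e * (D * q₁)) ≡ (1 + D) * (q₁ * q₂))
  (q₁⊥Dq₂ : Coprime q₁ (D * q₂)) (q₂⊥Dq₁ : Coprime q₂ (D * q₁)) (c<q₁ : c < q₁) (e<q₂ : e < q₂) where

  open Decomposition dec

  D′ : ℕ
  D′ = D * (q₁ * q₂)

  k′ : ℕ
  k′ = k + (c + e)

  denominators′ numerators′ : Vec ℕ k′
  denominators′ = denominators ++ replicate c q₁ ++ replicate e q₂
  numerators′   = map (q₁ * q₂ *_) numerators ++ replicate c (D * q₂) ++ replicate e (D * q₁)

  rescale : ∀ {d a} → d * a ≡ D → d * (q₁ * q₂ * a) ≡ D′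
  rescale {d} {a} eq = trans (reassoc d (q₁ * q₂) a) (cong (_* (q₁ * q₂)) eq)
    where
    reassoc : ∀ x y z → x * (y * z) ≡ x * z * y
    reassoc = ℕ-Solver.solve-∀

  rescaled : ∀ {n} {ds as : Vec ℕ n} → Pointwise (λ d a → d * a ≡ D) ds as →
             Pointwise (λ d a → d * a ≡ D′) ds (map (q₁ * q₂ *_) as)
  rescaled []         = []
  rescaled {ds = d ∷ _} {a ∷ _} (eq ∷ eqs) = rescale {d} {a} eq ∷ rescaled eqs

  replicated : ∀ n d a → d * a ≡ D′ → Pointwise (λ d a → d * a ≡ D′) (replicate n d) (replicate n a)
  replicated zero    d a eq = []
  replicated (suc n) d a eq = eq ∷ replicated n d a eq

  scaled′ : Pointwise (λ d a → d * a ≡ D′) denominators′ numerators′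
  scaled′ = ++⁺ (rescaled scaled)
                (++⁺ (replicated c q₁ (D * q₂) (exchange q₁ D q₂)) (replicated e q₂ (D * q₁) (rotate q₁ q₂ D)))
    where
    exchange : ∀ x y z → x * (y * z) ≡ y * (x * z)
    exchange = ℕ-Solver.solve-∀
    rotate : ∀ x y z → y * (z * x) ≡ z * (x * y)
    rotate = ℕ-Solver.solve-∀

  sumOver-numerators′ : ∀ J₀ J₁ J₂ → sumOver (J₀ ++ J₁ ++ J₂) numerators′
                        ≡ q₁ * q₂ * sumOver J₀ numerators + (∣ J₁ ∣ * (D * q₂) + ∣ J₂ ∣ * (D * q₁))
  sumOver-numerators′ J₀ J₁ J₂ = begin
    sumOver (J₀ ++ J₁ ++ J₂) numerators′
      ≡⟨ sumOver-++ J₀ (J₁ ++ J₂) _ _ ⟩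
    sumOver J₀ (map (q₁ * q₂ *_) numerators) + sumOver (J₁ ++ J₂) (replicate c (D * q₂) ++ replicate e (D * q₁))
      ≡⟨ cong₂ _+_ (sumOver-map-* (q₁ * q₂) J₀ numerators) (sumOver-++ J₁ J₂ _ _) ⟩
    q₁ * q₂ * sumOver J₀ numerators + (sumOver J₁ (replicate c (D * q₂)) + sumOver J₂ (replicate e (D * q₁)))
      ≡⟨ cong (_+_ (q₁ * q₂ * sumOver J₀ numerators)) (cong₂ _+_ (sumOver-replicate J₁ _) (sumOver-replicate J₂ _)) ⟩
    q₁ * q₂ * sumOver J₀ numerators + (∣ J₁ ∣ * (D * q₂) + ∣ J₂ ∣ * (D * q₁)) ∎

  replicate-split : (x : Side) → replicate k x ++ replicate c x ++ replicate e x ≡ replicate k′ x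
  replicate-split x = trans (cong (replicate k x ++_) (replicate-++ c e x)) (replicate-++ k (c + e) x)

  total′ : 1 + sumOver ⊤ numerators′ ≡ suc m * D′
  total′ = begin
    1 + sumOver ⊤ numerators′
      ≡⟨ cong (λ J → 1 + sumOver J numerators′) (sym (replicate-split inside)) ⟩
    1 + sumOver (⊤ {k} ++ ⊤ {c} ++ ⊤ {e}) numerators′
      ≡⟨ cong suc (sumOver-numerators′ ⊤ ⊤ ⊤) ⟩
    1 + (q₁ * q₂ * sumOver ⊤ numerators + (∣ ⊤ {c} ∣ * (D * q₂) + ∣ ⊤ {e} ∣ * (D * q₁)))
      ≡⟨ cong₂ (λ x y → 1 + (q₁ * q₂ * sumOver ⊤ numerators + (x * (D * q₂) + y * (D * q₁)))) (∣⊤∣≡n c) (∣⊤∣≡n e) ⟩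
    1 + (q₁ * q₂ * sumOver ⊤ numerators + (c * (D * q₂) + e * (D * q₁)))
      ≡⟨ rescaled-total {m} {D} {q₁ * q₂} total identity ⟩
    suc m * D′ ∎

  indivisible′ : ∀ J → D′ ∣ sumOver J numerators′ → J ≡ ⊥
  indivisible′ J D′∣ with splitAt k J
  ... | J₀ , J₁₂ , refl with splitAt c J₁₂
  ... | J₁ , J₂ , refl
    with ∣J₁∣≡0 , ∣J₂∣≡0 , D∣ ← indivisible-combination q₁⊥Dq₂ q₂⊥Dq₁
           (≤-<-trans (∣p∣≤n J₁) c<q₁) (≤-<-trans (∣p∣≤n J₂) e<q₂)
           (subst (D′ ∣_) (sumOver-numerators′ J₀ J₁ J₂) D′∣) = begin
    J₀ ++ J₁ ++ J₂ ≡⟨ cong₂ _++_ (indivisible J₀ D∣) (cong₂ _++_ (∣p∣≡0⇒p≡⊥ {p = J₁} ∣J₁∣≡0) (∣p∣≡0⇒p≡⊥ {p = J₂} ∣J₂∣≡0)) ⟩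
    ⊥ {k} ++ ⊥ {c} ++ ⊥ {e} ≡⟨ replicate-split outside ⟩
    ⊥              ∎

  extension : Decomposition (suc m) D′
  extension = record { scaled = scaled′ ; total = total′ ; indivisible = indivisible′ }

next : ∀ {m r} → Decomposition m (3 + r) → Decomposition (suc m) ((3 + r) * ((2 + r) * (5 + 2 * r)))
next {r = r} dec = Extension.extension dec (2 + r) (5 + 2 * r) (1 + r) 4 (identity r)
  (unit-Bézout⇒coprime (7 + 2 * r) 1 (q₁-inverse r))
  (Coprime.sym (unit-Bézout⇒coprime 4 (5 + 2 * r) (q₂-inverse r)))
  (n<1+n (1 + r)) (m≤m+n 5 (2 * r))
  where
  identity : ∀ r → 1 + ((1 + r) * ((3 + r) * (5 + 2 * r)) + 4 * ((3 + r) * (2 + r)))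
                   ≡ (4 + r) * ((2 + r) * (5 + 2 * r))
  identity = ℕ-Solver.solve-∀
  q₁-inverse : ∀ r → (7 + 2 * r) * (2 + r) + 1 ≡ 1 * ((3 + r) * (5 + 2 * r))
  q₁-inverse = ℕ-Solver.solve-∀
  q₂-inverse : ∀ r → 4 * ((3 + r) * (2 + r)) + 1 ≡ (5 + 2 * r) * (5 + 2 * r)
  q₂-inverse = ℕ-Solver.solve-∀

decomposition : ∀ m → ∃[ r ] Decomposition (suc m) (3 + r)
decomposition zero    = 3 , base
decomposition (suc m) = _ , next (proj₂ (decomposition m))

denominator-positive : ∀ {d a p} → d * a ≡ suc p → d ≥ 1
denominator-positive {suc d} _ = s≤s z≤n

module Representation {m p} (dec : Decomposition m (suc p)) where

  open Decomposition dec

  denominators₊ : Vec ℕ (suc k)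
  denominators₊ = suc p ∷ denominators

  scaled₊ : Pointwise (λ d a → d * a ≡ suc p) denominators₊ (1 ∷ numerators)
  scaled₊ = *-identityʳ (suc p) ∷ scaled

  denominators₊-positive : ∀ i → lookup denominators₊ i ≥ 1
  denominators₊-positive i = denominator-positive (Pointwise.lookup scaled₊ i)

  fullSum≡m : fullSum (lookup denominators₊) ≡ (+ m) / 1
  fullSum≡m = begin
    fullSum (lookup denominators₊)            ≡⟨ fullSum≡subsetSum⊤ (lookup denominators₊) ⟩
    subsetSum (lookup denominators₊) ⊤        ≡⟨ subsetSum-scaled scaled₊ ⊤ ⟩
    (+ (1 + sumOver ⊤ numerators)) / suc p    ≡⟨ cong (λ N → (+ N) / suc p) total ⟩
    (+ (m * suc p)) / suc p                   ≡⟨ /-cong-cross {m * suc p} {m} {p} {0} (*-identityʳ (m * suc p)) ⟩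
    (+ m) / 1                                 ∎

  proper-subsums-indivisible : ∀ I → Nonempty I → I ⊂ ⊤ → ¬ suc p ∣ sumOver I (1 ∷ numerators)
  proper-subsums-indivisible (outside ∷ J) (x , x∈I) _ D∣ =
    ∉⊥ (subst (λ J → x ∈ outside ∷ J) (indivisible J D∣) x∈I)
  proper-subsums-indivisible (inside ∷ J) _ (_ , Fin.zero , _ , 0∉I) _ = 0∉I here
  proper-subsums-indivisible (inside ∷ J) _ (_ , Fin.suc y , _ , y∉I) D∣ =
    ∉⊥ (subst (y ∈_) (indivisible (∁ J) D∣∁J) (x∉p⇒x∈∁p (y∉I ∘ there)))
    where
    D∣∁J : suc p ∣ sumOver (∁ J) numerators
    D∣∁J = ∣m+n∣m⇒∣n (subst (suc p ∣_) (sym (trans (cong suc (sumOver-∁ J numerators)) total)) (n∣m*n m)) D∣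

  no-integral-proper-subsum : ∀ I → Nonempty I → I ⊂ ⊤ → ¬ IsInteger (subsetSum (lookup denominators₊) I)
  no-integral-proper-subsum I ne I⊂⊤ (z , I≡z) =
    proper-subsums-indivisible I ne I⊂⊤ (/≡integer⇒∣ {z = z} (trans (sym (subsetSum-scaled scaled₊ I)) I≡z))

theorem1p1 : (m : ℕ) → m ≥ 1 →
    Σ ℕ λ k → k ≥ 1 × (Σ (Fin k → ℕ) λ n →
      ((i : Fin k) → n i ≥ 1)
      × fullSum n ≡ (+ m) / 1
      × ((I : Subset k) → Nonempty I → I ⊂ ⊤ → ¬ IsInteger (subsetSum n I)))
theorem1p1 zero ()
theorem1p1 (suc m) _ with decomposition m
... | _ , dec = suc k , s≤s z≤n , lookup denominators₊ , denominators₊-positive , fullSum≡m , no-integral-proper-subsum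
  where
  open Decomposition dec
  open Representation dec
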